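{- For every basis $\Gamma$, computations $M,N$ of $\lambda_c^u$ and computation type $\tau$: if $\Gamma\vdash M:\tau$ and $N\longrightarrow M$, then $\Gamma\vdash N:\tau$.
   Context: Syntax of $\lambda_c^u$: values $V ::= x\mid \lambda x.M$, computations $M ::= \mathit{unit}\,V\mid M\star V$. One-step reduction $\longrightarrow$ is the closure under all (value/computation) contexts of the rules $\mathit{unit}\,V\star(\lambda x.M)\to M[V/x]$, $M\star\lambda x.\mathit{unit}\,x\to M$, and $(L\star\lambda x.M)\star\lambda y.N\to L\star\lambda x.(M\star\lambda y.N)$ for $x\notin FV(N)$. Types: value types $\delta ::= \alpha\mid \delta\to\tau\mid \delta\wedge\delta\mid \omega_{\mathsf V}$, computation types $\tau ::= T\delta\mid \tau\wedge\tau\mid \omega_{\mathsf C}$. The preorders $\le_{\mathsf V},\le_{\mathsf C}$ are the least preorders such that, for each sort, $\omega$ is top, $\wedge$ is monotone, idempotent and commutative, $\sigma\wedge\sigma'\le\sigma$, and $\sigma\le\sigma',\sigma\le\sigma''\Rightarrow\sigma\le\sigma'\wedge\sigma''$; moreover $\omega_{\mathsf V}\le_{\mathsf V}\omega_{\mathsf V}\to\omega_{\mathsf C}$, $(\delta\to\tau)\wedge(\delta\to\tau')\le_{\mathsf V}\delta\to(\tau\wedge\tau')$, $\delta'\le_{\mathsf V}\delta,\tau\le_{\mathsf C}\tau'\Rightarrow\delta\to\tau\le_{\mathsf V}\delta'\to\tau'$, $T\delta\wedge T\delta'\le_{\mathsf C}T(\delta\wedge\delta')$, $\delta\le_{\mathsf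 V}\delta'\Rightarrow T\delta\le_{\mathsf C}T\delta'$. A basis is a finite set of assumptions $x_i:\delta_i$ with distinct variables. Typing rules: (Ax) $x:\delta\in\Gamma\Rightarrow\Gamma\vdash x:\delta$; ($\to$I) $\Gamma,x:\delta\vdash M:\tau\Rightarrow\Gamma\vdash\lambda x.M:\delta\to\tau$; (unit I) $\Gamma\vdash V:\delta\Rightarrow\Gamma\vdash\mathit{unit}\,V:T\delta$; ($\to$E) $\Gamma\vdash M:T\delta,\ \Gamma\vdash V:\delta\to\tau\Rightarrow\Gamma\vdash M\star V:\tau$; and for each sort: ($\omega$) $\Gamma\vdash P:\omega$; ($\wedge$I) from $\Gamma\vdash P:\sigma$ and $\Gamma\vdash P:\sigma'$ infer $\Gamma\vdash P:\sigma\wedge\sigma'$; ($\le$) from $\Gamma\vdash P:\sigma$ and $\sigma\le\sigma'$ infer $\Gamma\vdash P:\sigma'$. -}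

module Defs where

open import Data.Nat using (ℕ; zero; suc)
open import Data.List using (List; []; _∷_)
open import Data.Maybe using (Maybe; just; nothing)
open import Relation.Binary.PropositionalEquality using (_≡_)

-- Syntax of λ_c^u, with (unscoped) de Bruijn indices for variables.

mutual
  data Val : Set where
    var : ℕ → Val
    lam : Comp → Val

  data Comp : Set where
    unit : Val → Comp
    _⋆_  : Comp → Val → Comp

infixl 5 _⋆_

ext : (ℕ → ℕ) → ℕ → ℕ
ext ρ zero    = zero
ext ρ (suc i) = suc (ρ i)

mutual
  renV : (ℕ → ℕ) → Val → Val
  renV ρ (var i) = var (ρ i)
  renV ρ (lam M) = lam (renC (ext ρ) M)

  renC : (ℕ → ℕ) → Comp → Comp
  renC ρ (unit V) = unit (renV ρ V)
  renC ρ (M ⋆ V)  = renC ρ M ⋆ renV ρ V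

exts : (ℕ → Val) → ℕ → Val
exts σ zero    = var zero
exts σ (suc i) = renV suc (σ i)

mutual
  subV : (ℕ → Val) → Val → Val
  subV σ (var i) = σ i
  subV σ (lam M) = lam (subC (exts σ) M)

  subC : (ℕ → Val) → Comp → Comp
  subC σ (unit V) = unit (subV σ V)
  subC σ (M ⋆ V)  = subC σ M ⋆ subV σ V

single : Val → ℕ → Val
single V zero    = V
single V (suc i) = var i

_[_] : Comp → Val → Comp
M [ V ] = subC (single V) M

-- weakening at index 1: turns N (under binder y) into N under binders x,y
-- with x ∉ FV(N)
wk1 : Comp → Comp
wk1 N = renC (ext suc) N

mutual
  data _⟶v_ : Val → Val → Set where
    ξ-lam : ∀ {M M'} → M ⟶c M' → lam M ⟶v lam M'

  data _⟶c_ : Comp → Comp → Set where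
    β      : ∀ {V M} → (unit V ⋆ lam M) ⟶c (M [ V ])
    η-unit : ∀ {M} → (M ⋆ lam (unit (var zero))) ⟶c M
    assoc  : ∀ {L M N} →
             ((L ⋆ lam M) ⋆ lam N) ⟶c (L ⋆ lam (M ⋆ lam (wk1 N)))
    ξ-unit : ∀ {V V'} → V ⟶v V' → unit V ⟶c unit V'
    ξ-⋆ˡ   : ∀ {M M' V} → M ⟶c M' → (M ⋆ V) ⟶c (M' ⋆ V)
    ξ-⋆ʳ   : ∀ {M V V'} → V ⟶v V' → (M ⋆ V) ⟶c (M ⋆ V')

infix 3 _⟶v_ _⟶c_

mutual
  data VType : Set where
    atom : ℕ → VType
    _⇒_  : VType → CType → VType
    _∧v_ : VType → VType → VType
    ωV   : VType

  data CType : Set where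
    T    : VType → CType
    _∧c_ : CType → CType → CType
    ωC   : CType

infixr 6 _⇒_
infixl 7 _∧v_ _∧c_

mutual
  data _≤V_ : VType → VType → Set where
    reflV   : ∀ {δ} → δ ≤V δ
    transV  : ∀ {δ δ' δ''} → δ ≤V δ' → δ' ≤V δ'' → δ ≤V δ''
    topV    : ∀ {δ} → δ ≤V ωV
    monoV   : ∀ {δ₁ δ₂ δ₁' δ₂'} → δ₁ ≤V δ₁' → δ₂ ≤V δ₂' → (δ₁ ∧v δ₂) ≤V (δ₁' ∧v δ₂')
    idem₁V  : ∀ {δ} → (δ ∧v δ) ≤V δ
    idem₂V  : ∀ {δ} → δ ≤V (δ ∧v δ)
    commV   : ∀ {δ δ'} → (δ ∧v δ') ≤V (δ' ∧v δ)
    projV   : ∀ {δ δ'} → (δ ∧v δ') ≤V δ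
    glbV    : ∀ {δ δ' δ''} → δ ≤V δ' → δ ≤V δ'' → δ ≤V (δ' ∧v δ'')
    ωarrow  : ωV ≤V (ωV ⇒ ωC)
    distArr : ∀ {δ τ τ'} → ((δ ⇒ τ) ∧v (δ ⇒ τ')) ≤V (δ ⇒ (τ ∧c τ'))
    arrow   : ∀ {δ δ' τ τ'} → δ' ≤V δ → τ ≤C τ' → (δ ⇒ τ) ≤V (δ' ⇒ τ')

  data _≤C_ : CType → CType → Set where
    reflC   : ∀ {τ} → τ ≤C τ
    transC  : ∀ {τ τ' τ''} → τ ≤C τ' → τ' ≤C τ'' → τ ≤C τ''
    topC    : ∀ {τ} → τ ≤C ωC
    monoC   : ∀ {τ₁ τ₂ τ₁' τ₂'} → τ₁ ≤C τ₁' → τ₂ ≤C τ₂' → (τ₁ ∧c τ₂) ≤C (τ₁' ∧c τ₂')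
    idem₁C  : ∀ {τ} → (τ ∧c τ) ≤C τ
    idem₂C  : ∀ {τ} → τ ≤C (τ ∧c τ)
    commC   : ∀ {τ τ'} → (τ ∧c τ') ≤C (τ' ∧c τ)
    projC   : ∀ {τ τ'} → (τ ∧c τ') ≤C τ
    glbC    : ∀ {τ τ' τ''} → τ ≤C τ' → τ ≤C τ'' → τ ≤C (τ' ∧c τ'')
    distT   : ∀ {δ δ'} → (T δ ∧c T δ') ≤C T (δ ∧v δ')
    monoT   : ∀ {δ δ'} → δ ≤V δ' → T δ ≤C T δ'

infix 4 _≤V_ _≤C_

-- Bases: a finite partial assignment of value types to variables.
-- Position i of the list is the assumption (if any) for de Bruijn index i.
-- Distinctness of variables is automatic.

Basis : Set
Basis = List (Maybe VType)

data _∋_∶_ : Basis → ℕ → VType → Set where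
  here  : ∀ {Γ δ} → (just δ ∷ Γ) ∋ zero ∶ δ
  there : ∀ {Γ o i δ} → Γ ∋ i ∶ δ → (o ∷ Γ) ∋ suc i ∶ δ

mutual
  data _⊢v_∶_ : Basis → Val → VType → Set where
    ax   : ∀ {Γ i δ} → Γ ∋ i ∶ δ → Γ ⊢v var i ∶ δ
    ⇒I   : ∀ {Γ δ M τ} → (just δ ∷ Γ) ⊢c M ∶ τ → Γ ⊢v lam M ∶ (δ ⇒ τ)
    ωIv  : ∀ {Γ V} → Γ ⊢v V ∶ ωV
    ∧Iv  : ∀ {Γ V δ δ'} → Γ ⊢v V ∶ δ → Γ ⊢v V ∶ δ' → Γ ⊢v V ∶ (δ ∧v δ')
    ≤v   : ∀ {Γ V δ δ'} → Γ ⊢v V ∶ δ → δ ≤V δ' → Γ ⊢v V ∶ δ'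

  data _⊢c_∶_ : Basis → Comp → CType → Set where
    unitI : ∀ {Γ V δ} → Γ ⊢v V ∶ δ → Γ ⊢c unit V ∶ T δ
    ⇒E    : ∀ {Γ M V δ τ} → Γ ⊢c M ∶ T δ → Γ ⊢v V ∶ (δ ⇒ τ) → Γ ⊢c (M ⋆ V) ∶ τ
    ωIc   : ∀ {Γ M} → Γ ⊢c M ∶ ωC
    ∧Ic   : ∀ {Γ M τ τ'} → Γ ⊢c M ∶ τ → Γ ⊢c M ∶ τ' → Γ ⊢c M ∶ (τ ∧c τ')
    ≤c    : ∀ {Γ M τ τ'} → Γ ⊢c M ∶ τ → τ ≤C τ' → Γ ⊢c M ∶ τ'

infix 2 _⊢v_∶_ _⊢c_∶_

-- For β, a type of M[V/x]
-- is decomposed into a type of M under x : δ and a type δ of V; the different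
-- occurrences of V may need different types, and intersection merges them into
-- one. For η and associativity one has to invert typings of λ-abstractions,
-- which rests on the arrow inversion property of ≤:
-- if ⋀ᵢ (δᵢ → τᵢ) ≤ δ → τ then ⋀ { τᵢ | δ ≤ δᵢ } ≤ τ.
module Submission where

open import Defs
open import Data.Nat using (ℕ; zero; suc)
open import Data.List using ([]; _∷_; _++_; length)
open import Data.Maybe using (just)
open import Data.Product using (Σ; _×_; _,_; map₂)
open import Function using (id; _∘_)

proj₂V : ∀ {δ δ'} → δ ∧v δ' ≤V δ'
proj₂V = transV commV projV

proj₂C : ∀ {τ τ'} → τ ∧c τ' ≤C τ'
proj₂C = transC commC projC

record IsFilterV (P : VType → Set) : Set where
  field
    ωV-closed : P ωV
    ∧v-closed : ∀ {δ δ'} → P δ → P δ' → P (δ ∧v δ')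
    ≤V-closed : ∀ {δ δ'} → P δ → δ ≤V δ' → P δ'

record IsFilterC (P : CType → Set) : Set where
  field
    ωC-closed : P ωC
    ∧c-closed : ∀ {τ τ'} → P τ → P τ' → P (τ ∧c τ')
    ≤C-closed : ∀ {τ τ'} → P τ → τ ≤C τ' → P τ'

open IsFilterV
open IsFilterC

⊢v-isFilter : ∀ {Γ V} → IsFilterV (Γ ⊢v V ∶_)
⊢v-isFilter = record { ωV-closed = ωIv ; ∧v-closed = ∧Iv ; ≤V-closed = ≤v }

⊢c-isFilter : ∀ {Γ M} → IsFilterC (Γ ⊢c M ∶_)
⊢c-isFilter = record { ωC-closed = ωIc ; ∧c-closed = ∧Ic ; ≤C-closed = ≤c }

data ⟨_⟩ (B : CType → Set) : CType → Set where
  gen  : ∀ {τ} → B τ → ⟨ B ⟩ τ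
  top  : ⟨ B ⟩ ωC
  meet : ∀ {τ τ'} → ⟨ B ⟩ τ → ⟨ B ⟩ τ' → ⟨ B ⟩ (τ ∧c τ')
  up   : ∀ {τ τ'} → ⟨ B ⟩ τ → τ ≤C τ' → ⟨ B ⟩ τ'

⟨⟩-isFilter : ∀ {B} → IsFilterC ⟨ B ⟩
⟨⟩-isFilter = record { ωC-closed = top ; ∧c-closed = meet ; ≤C-closed = up }

⟨⟩-least : ∀ {B P} → IsFilterC P → (∀ {τ} → B τ → P τ) → ∀ {τ} → ⟨ B ⟩ τ → P τ
⟨⟩-least F f (gen b)    = f b
⟨⟩-least F f top        = ωC-closed F
⟨⟩-least F f (meet b c) = ∧c-closed F (⟨⟩-least F f b) (⟨⟩-least F f c)
⟨⟩-least F f (up b l)   = ≤C-closed F (⟨⟩-least F f b) l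

⟨⟩-bind : ∀ {B B'} → (∀ {τ} → B τ → ⟨ B' ⟩ τ) → ∀ {τ} → ⟨ B ⟩ τ → ⟨ B' ⟩ τ
⟨⟩-bind = ⟨⟩-least ⟨⟩-isFilter

unit-gen : ∀ {P Γ V} → IsFilterC P → (∀ {δ} → Γ ⊢v V ∶ δ → P (T δ)) →
           ∀ {τ} → Γ ⊢c unit V ∶ τ → P τ
unit-gen F f (unitI d)  = f d
unit-gen F f ωIc        = ωC-closed F
unit-gen F f (∧Ic d e)  = ∧c-closed F (unit-gen F f d) (unit-gen F f e)
unit-gen F f (≤c d l)   = ≤C-closed F (unit-gen F f d) l

⋆-gen : ∀ {P Γ M V} → IsFilterC P →
        (∀ {δ τ} → Γ ⊢c M ∶ T δ → Γ ⊢v V ∶ δ ⇒ τ → P τ) →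
        ∀ {τ} → Γ ⊢c M ⋆ V ∶ τ → P τ
⋆-gen F f (⇒E d e)   = f d e
⋆-gen F f ωIc        = ωC-closed F
⋆-gen F f (∧Ic d e)  = ∧c-closed F (⋆-gen F f d) (⋆-gen F f e)
⋆-gen F f (≤c d l)   = ≤C-closed F (⋆-gen F f d) l

lam-gen : ∀ {P Γ M} → IsFilterV P →
          (∀ {δ τ} → just δ ∷ Γ ⊢c M ∶ τ → P (δ ⇒ τ)) →
          ∀ {σ} → Γ ⊢v lam M ∶ σ → P σ
lam-gen F f (⇒I d)     = f d
lam-gen F f ωIv        = ωV-closed F
lam-gen F f (∧Iv d e)  = ∧v-closed F (lam-gen F f d) (lam-gen F f e)
lam-gen F f (≤v d l)   = ≤V-closed F (lam-gen F f d) l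

var-transport : ∀ {Γ Γ' i j} → (∀ {δ} → Γ ∋ i ∶ δ → Γ' ∋ j ∶ δ) →
                ∀ {δ} → Γ ⊢v var i ∶ δ → Γ' ⊢v var j ∶ δ
var-transport f (ax x)     = ax (f x)
var-transport f ωIv        = ωIv
var-transport f (∧Iv d e)  = ∧Iv (var-transport f d) (var-transport f e)
var-transport f (≤v d l)   = ≤v (var-transport f d) l

infix 4 _⊑_

_⊑_ : Basis → Basis → Set
Γ ⊑ Γ' = ∀ {i δ} → Γ ∋ i ∶ δ → Σ VType λ δ' → (Γ' ∋ i ∶ δ') × (δ' ≤V δ)

⊑-head : ∀ {Γ δ δ'} → δ' ≤V δ → just δ ∷ Γ ⊑ just δ' ∷ Γ
⊑-head le here      = _ , here , le
⊑-head le (there x) = _ , there x , reflV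

⊑-cons : ∀ {Γ Γ' o} → Γ ⊑ Γ' → o ∷ Γ ⊑ o ∷ Γ'
⊑-cons h here      = _ , here , reflV
⊑-cons h (there x) = map₂ (λ (y , l) → there y , l) (h x)

⊑-at : ∀ Γ₁ {Γ₂ δ δ'} → δ' ≤V δ → Γ₁ ++ just δ ∷ Γ₂ ⊑ Γ₁ ++ just δ' ∷ Γ₂
⊑-at []       le = ⊑-head le
⊑-at (o ∷ Γ₁) le = ⊑-cons (⊑-at Γ₁ le)

mutual
  narrowV : ∀ {Γ Γ' V δ} → Γ ⊑ Γ' → Γ ⊢v V ∶ δ → Γ' ⊢v V ∶ δ
  narrowV h (ax x) with h x
  ... | _ , y , l = ≤v (ax y) l
  narrowV h (⇒I d)     = ⇒I (narrowC (⊑-cons h) d)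
  narrowV h ωIv        = ωIv
  narrowV h (∧Iv d e)  = ∧Iv (narrowV h d) (narrowV h e)
  narrowV h (≤v d l)   = ≤v (narrowV h d) l

  narrowC : ∀ {Γ Γ' M τ} → Γ ⊑ Γ' → Γ ⊢c M ∶ τ → Γ' ⊢c M ∶ τ
  narrowC h (unitI d)  = unitI (narrowV h d)
  narrowC h (⇒E d e)   = ⇒E (narrowC h d) (narrowV h e)
  narrowC h ωIc        = ωIc
  narrowC h (∧Ic d e)  = ∧Ic (narrowC h d) (narrowC h e)
  narrowC h (≤c d l)   = ≤c (narrowC h d) l

data Accepts : VType → VType → CType → Set where
  here : ∀ {δ δ' τ} → δ ≤V δ' → Accepts (δ' ⇒ τ) δ τ
  inˡ  : ∀ {σ₁ σ₂ δ τ} → Accepts σ₁ δ τ → Accepts (σ₁ ∧v σ₂) δ τ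
  inʳ  : ∀ {σ₁ σ₂ δ τ} → Accepts σ₂ δ τ → Accepts (σ₁ ∧v σ₂) δ τ

-- For σ = ⋀ᵢ (δᵢ → τᵢ), Result σ δ τ says ⋀ { τᵢ | δ ≤ δᵢ } ≤ τ,
-- without having to decide δ ≤ δᵢ.
Result : VType → VType → CType → Set
Result σ δ = ⟨ Accepts σ δ ⟩

Result-∧ˡ : ∀ {σ₁ σ₂ δ τ} → Result σ₁ δ τ → Result (σ₁ ∧v σ₂) δ τ
Result-∧ˡ = ⟨⟩-bind (gen ∘ inˡ)

Result-∧ʳ : ∀ {σ₁ σ₂ δ τ} → Result σ₂ δ τ → Result (σ₁ ∧v σ₂) δ τ
Result-∧ʳ = ⟨⟩-bind (gen ∘ inʳ)

Result-antitone : ∀ {σ σ'} → σ ≤V σ' → ∀ {δ τ} → Result σ' δ τ → Result σ δ τ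
Result-antitone reflV        = id
Result-antitone (transV p q) = Result-antitone p ∘ Result-antitone q
Result-antitone topV         = ⟨⟩-bind λ ()
Result-antitone (monoV p q)  = ⟨⟩-bind λ
  { (inˡ a) → Result-∧ˡ (Result-antitone p (gen a))
  ; (inʳ a) → Result-∧ʳ (Result-antitone q (gen a)) }
Result-antitone idem₁V       = Result-∧ˡ
Result-antitone idem₂V       = ⟨⟩-bind λ { (inˡ a) → gen a ; (inʳ a) → gen a }
Result-antitone commV        = ⟨⟩-bind λ { (inˡ a) → gen (inʳ a) ; (inʳ a) → gen (inˡ a) }
Result-antitone projV        = Result-∧ˡ
Result-antitone (glbV p q)   = ⟨⟩-bind λ
  { (inˡ a) → Result-antitone p (gen a)
  ; (inʳ a) → Result-antitone q (gen a) }
Result-antitone ωarrow       = ⟨⟩-bind λ { (here _) → top }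
Result-antitone distArr      = ⟨⟩-bind λ { (here l) → meet (gen (inˡ (here l))) (gen (inʳ (here l))) }
Result-antitone (arrow p q)  = ⟨⟩-bind λ { (here l) → up (gen (here (transV l p))) q }

lam-result : ∀ {Γ M σ} → Γ ⊢v lam M ∶ σ → ∀ {δ τ} → Result σ δ τ → just δ ∷ Γ ⊢c M ∶ τ
lam-result (⇒I d)    = ⟨⟩-least ⊢c-isFilter λ { (here l) → narrowC (⊑-head l) d }
lam-result ωIv       = ⟨⟩-least ⊢c-isFilter λ ()
lam-result (∧Iv d e) = ⟨⟩-least ⊢c-isFilter λ
  { (inˡ a) → lam-result d (gen a)
  ; (inʳ a) → lam-result e (gen a) }
lam-result (≤v d l)  = lam-result d ∘ Result-antitone l

lam-inv : ∀ {Γ M δ τ} → Γ ⊢v lam M ∶ δ ⇒ τ → just δ ∷ Γ ⊢c M ∶ τ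
lam-inv d = lam-result d (gen (here reflV))

Reflects : (ℕ → ℕ) → Basis → Basis → Set
Reflects ρ Δ Γ = ∀ {i δ} → Δ ∋ ρ i ∶ δ → Γ ∋ i ∶ δ

Reflects-suc : ∀ {o Γ} → Reflects suc (o ∷ Γ) Γ
Reflects-suc (there x) = x

Reflects-ext : ∀ {ρ Δ Γ o} → Reflects ρ Δ Γ → Reflects (ext ρ) (o ∷ Δ) (o ∷ Γ)
Reflects-ext h {zero}  here      = here
Reflects-ext h {suc i} (there x) = there (h x)

mutual
  strengthenV : ∀ {Γ Δ} ρ → Reflects ρ Δ Γ → ∀ W {δ} → Δ ⊢v renV ρ W ∶ δ → Γ ⊢v W ∶ δ
  strengthenV ρ h (var i) = var-transport h
  strengthenV ρ h (lam M) =
    lam-gen ⊢v-isFilter (⇒I ∘ strengthenC (ext ρ) (Reflects-ext h) M)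

  strengthenC : ∀ {Γ Δ} ρ → Reflects ρ Δ Γ → ∀ M {τ} → Δ ⊢c renC ρ M ∶ τ → Γ ⊢c M ∶ τ
  strengthenC ρ h (unit V) = unit-gen ⊢c-isFilter (unitI ∘ strengthenV ρ h V)
  strengthenC ρ h (M ⋆ V)  =
    ⋆-gen ⊢c-isFilter λ d e → ⇒E (strengthenC ρ h M d) (strengthenV ρ h V e)

substAt : Val → ℕ → ℕ → Val
substAt V zero    = single V
substAt V (suc k) = exts (substAt V k)

Expansion : Basis → Basis → Val → (Basis → Set) → Set
Expansion Γ₁ Γ₂ V J = Σ VType λ δ → (Γ₂ ⊢v V ∶ δ) × J (Γ₁ ++ just δ ∷ Γ₂)

Expansion-isFilterV : ∀ Γ₁ {Γ₂ V W} → IsFilterV (λ δ' → Expansion Γ₁ Γ₂ V (_⊢v W ∶ δ'))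
Expansion-isFilterV Γ₁ = record
  { ωV-closed = ωV , ωIv , ωIv
  ; ∧v-closed = λ (δ₁ , v₁ , d₁) (δ₂ , v₂ , d₂) →
      δ₁ ∧v δ₂ , ∧Iv v₁ v₂ ,
      ∧Iv (narrowV (⊑-at Γ₁ projV) d₁) (narrowV (⊑-at Γ₁ proj₂V) d₂)
  ; ≤V-closed = λ (δ , v , d) l → δ , v , ≤v d l
  }

Expansion-isFilterC : ∀ Γ₁ {Γ₂ V M} → IsFilterC (λ τ → Expansion Γ₁ Γ₂ V (_⊢c M ∶ τ))
Expansion-isFilterC Γ₁ = record
  { ωC-closed = ωV , ωIv , ωIc
  ; ∧c-closed = λ (δ₁ , v₁ , d₁) (δ₂ , v₂ , d₂) →
      δ₁ ∧v δ₂ , ∧Iv v₁ v₂ ,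
      ∧Ic (narrowC (⊑-at Γ₁ projV) d₁) (narrowC (⊑-at Γ₁ proj₂V) d₂)
  ; ≤C-closed = λ (δ , v , d) l → δ , v , ≤c d l
  }

∋-head : ∀ {o Γ Γ' δ} → (o ∷ Γ) ∋ zero ∶ δ → (o ∷ Γ') ∋ zero ∶ δ
∋-head here = here

var-expand : ∀ Γ₁ {Γ₂} V i {δ'} → Γ₁ ++ Γ₂ ⊢v substAt V (length Γ₁) i ∶ δ' →
             Expansion Γ₁ Γ₂ V (_⊢v var i ∶ δ')
var-expand []       V zero    d = _ , d , ax here
var-expand []       V (suc i) d = ωV , ωIv , var-transport there d
var-expand (o ∷ Γ₁) V zero    d = ωV , ωIv , var-transport ∋-head d
var-expand (o ∷ Γ₁) V (suc i) d =
  map₂ (map₂ (var-transport there))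
       (var-expand Γ₁ V i (strengthenV suc Reflects-suc (substAt V (length Γ₁) i) d))

mutual
  subV-expand : ∀ Γ₁ {Γ₂} V W {δ'} → Γ₁ ++ Γ₂ ⊢v subV (substAt V (length Γ₁)) W ∶ δ' →
                Expansion Γ₁ Γ₂ V (_⊢v W ∶ δ')
  subV-expand Γ₁ V (var i) = var-expand Γ₁ V i
  subV-expand Γ₁ V (lam M) =
    lam-gen (Expansion-isFilterV Γ₁) (map₂ (map₂ ⇒I) ∘ subC-expand (just _ ∷ Γ₁) V M)

  subC-expand : ∀ Γ₁ {Γ₂} V M {τ} → Γ₁ ++ Γ₂ ⊢c subC (substAt V (length Γ₁)) M ∶ τ →
                Expansion Γ₁ Γ₂ V (_⊢c M ∶ τ)
  subC-expand Γ₁ V (unit W) =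
    unit-gen (Expansion-isFilterC Γ₁) (map₂ (map₂ unitI) ∘ subV-expand Γ₁ V W)
  subC-expand Γ₁ V (M ⋆ W) = ⋆-gen (Expansion-isFilterC Γ₁) λ d e →
    let (δ₁ , v₁ , d₁) = subC-expand Γ₁ V M d
        (δ₂ , v₂ , d₂) = subV-expand Γ₁ V W e
    in δ₁ ∧v δ₂ , ∧Iv v₁ v₂ ,
       ⇒E (narrowC (⊑-at Γ₁ projV) d₁) (narrowV (⊑-at Γ₁ proj₂V) d₂)

β-expand : ∀ {Γ V M τ} → Γ ⊢c M [ V ] ∶ τ → Γ ⊢c unit V ⋆ lam M ∶ τ
β-expand {V = V} {M} d =
  let (_ , v , d') = subC-expand [] V M d in ⇒E (unitI v) (⇒I d')

η-expand : ∀ {Γ M} τ → Γ ⊢c M ∶ τ → Γ ⊢c M ⋆ lam (unit (var zero)) ∶ τ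
η-expand (T δ)      d = ⇒E d (⇒I (unitI (ax here)))
η-expand (τ₁ ∧c τ₂) d = ∧Ic (η-expand τ₁ (≤c d projC)) (η-expand τ₂ (≤c d proj₂C))
η-expand ωC         d = ωIc

assoc-expand : ∀ {Γ L M N τ} → Γ ⊢c L ⋆ lam (M ⋆ lam (wk1 N)) ∶ τ →
               Γ ⊢c (L ⋆ lam M) ⋆ lam N ∶ τ
assoc-expand {N = N} = ⋆-gen ⊢c-isFilter λ dL dV →
  ⋆-gen ⊢c-isFilter (λ dM dW →
    ⇒E (⇒E dL (⇒I dM)) (⇒I (strengthenC (ext suc) (Reflects-ext Reflects-suc) N (lam-inv dW))))
  (lam-inv dV)

mutual
  ⟶v-expand : ∀ {Γ V V' δ} → V ⟶v V' → Γ ⊢v V' ∶ δ → Γ ⊢v V ∶ δ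
  ⟶v-expand (ξ-lam r) = lam-gen ⊢v-isFilter (⇒I ∘ ⟶c-expand r)

  ⟶c-expand : ∀ {Γ N M τ} → N ⟶c M → Γ ⊢c M ∶ τ → Γ ⊢c N ∶ τ
  ⟶c-expand β          = β-expand
  ⟶c-expand η-unit     = η-expand _
  ⟶c-expand assoc      = assoc-expand
  ⟶c-expand (ξ-unit r) = unit-gen ⊢c-isFilter (unitI ∘ ⟶v-expand r)
  ⟶c-expand (ξ-⋆ˡ r)   = ⋆-gen ⊢c-isFilter λ d e → ⇒E (⟶c-expand r d) e
  ⟶c-expand (ξ-⋆ʳ r)   = ⋆-gen ⊢c-isFilter λ d e → ⇒E d (⟶v-expand r e)

mainTheorem4 : (Γ : Basis) (M N : Comp) (τ : CType) →
    Γ ⊢c M ∶ τ → N ⟶c M → Γ ⊢c N ∶ τ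
mainTheorem4 Γ M N τ d r = ⟶c-expand r d
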